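{- At every time during the execution of $\mathrm{DASH}$, the set $E_h$ of edges added by the algorithm forms a forest.
   Context: Model: the network is initially a connected undirected graph $G_0$ on $n$ nodes. In each round an adversary deletes one node $x$. The former neighbours of $x$ may then add edges only among themselves. $G$ denotes the current network. $E_h$ is the set of edges added by the healing algorithm so far, and $G_h=(V,E_h)$ on the current node set $V$. $N(v,G)$ and $N(v,G_h)$ are the neighbour sets of $v$ in $G$ and in $G_h$. $\delta(v)$ is the current degree of $v$ minus its degree in $G_0$. Algorithm $\mathrm{DASH}$: initially every node gets an independent uniform random ID in $[0,1]$. When $v$ is deleted, the neighbours of $v$ in $G$ whose ID differs from $v$'s are partitioned into classes of equal ID. $UN(v,G)$ contains one node per class (lowest initial ID). The nodes of $S=UN(v,G)\cup N(v,G_h)$ are joined by new edges into a complete binary tree, filled top-down and left to right in increasing order of $\delta$. The minimum ID of the nodes of $S$ is then propagated in $G_h$ to all nodes of the tree of $G_h$ containing $S$, which adopt it as their ID. -}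

module Defs where

open import Data.Bool using (Bool; true; false; _∧_; _∨_; not; T)
open import Data.Nat using (ℕ; zero; suc; _≤_; _*_; _+_; _⊓_; _≡ᵇ_; _≤ᵇ_)
open import Data.Integer as ℤ using (ℤ; +_; _-_)
open import Data.Fin using (Fin; _≟_)
open import Data.List using (List; []; _∷_; length; filterᵇ; upTo; concatMap; _++_; foldr)
open import Data.List.Relation.Unary.All using (All)
open import Data.List.Relation.Unary.Linked using (Linked)
open import Data.List.Relation.Unary.Unique.Propositional using (Unique)
open import Data.List.Relation.Binary.Permutation.Propositional using (_↭_)
open import Data.List.Membership.Propositional using (_∈_)
open import Data.Fin.Base using (Fin)
open import Data.Bool.ListAction using (any; all)
open import Data.Maybe using (Maybe; just; nothing)
open import Data.Product using (Σ; _×_; _,_)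
open import Relation.Nullary using (¬_)
open import Relation.Nullary.Decidable using (⌊_⌋)
open import Relation.Binary.PropositionalEquality using (_≡_)

allFin : (n : ℕ) → List (Fin n)
allFin n = Data.List.allFin n

_==F_ : ∀ {n} → Fin n → Fin n → Bool
a ==F b = ⌊ a ≟ b ⌋

data Reach {n : ℕ} (adj : Fin n → Fin n → Bool) : Fin n → Fin n → Set where
  here : ∀ {u} → Reach adj u u
  step : ∀ {u v w} → T (adj u v) → Reach adj v w → Reach adj u w

-- State of the network during the execution of DASH.
--   alive : the current node set V
--   adj   : the current network G (restricted to alive nodes)
--   hadj  : the healing graph G_h = (V, E_h)
--   ident : the current IDs
record State (n : ℕ) : Set where
  field
    alive : Fin n → Bool
    adj   : Fin n → Fin n → Bool
    hadj  : Fin n → Fin n → Bool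
    ident : Fin n → ℕ
open State public

at : ∀ {A : Set} → List A → ℕ → Maybe A
at []       _       = nothing
at (a ∷ as) zero    = just a
at (a ∷ as) (suc i) = at as i

pairOf : ∀ {A : Set} → Maybe A → Maybe A → List (A × A)
pairOf (just a) (just b) = (a , b) ∷ []
pairOf _        _        = []

-- edges of the complete binary tree filled top-down, left to right with
-- the elements of L in order: position i has children 2i+1 and 2i+2
btEdges : ∀ {A : Set} → List A → List (A × A)
btEdges L = concatMap (λ i → pairOf (at L i) (at L (suc (2 * i)))
                             ++ pairOf (at L i) (at L (suc (suc (2 * i)))))
                      (upTo (length L))

isEdge : ∀ {n} → List (Fin n × Fin n) → Fin n → Fin n → Bool
isEdge es u w = any (λ { (a , b) → (a ==F u ∧ b ==F w) ∨ (a ==F w ∧ b ==F u) }) es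

deg : ∀ {n} → (Fin n → Bool) → (Fin n → Fin n → Bool) → Fin n → ℕ
deg {n} alv a v = length (filterᵇ (λ u → alv u ∧ a v u) (allFin n))

-- minimum of f over a list (value on [] is irrelevant)
minOf : ∀ {n} → (Fin n → ℕ) → List (Fin n) → ℕ
minOf f []       = 0
minOf f (u ∷ us) = foldr (λ w r → f w ⊓ r) (f u) us

module DASH {n : ℕ} (adj0 : Fin n → Fin n → Bool) (initID : Fin n → ℕ) where

  initState : State n
  initState = record { alive = λ _ → true ; adj = adj0
                     ; hadj = λ _ _ → false ; ident = initID }

  module _ (s : State n) (x : Fin n) where

    alive' : Fin n → Bool
    alive' u = alive s u ∧ not (x ==F u)

    δ : Fin n → ℤ
    δ v = (+ deg alive' (adj s) v) - (+ deg (λ _ → true) adj0 v)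

    nbr : Fin n → Bool
    nbr u = alive s u ∧ adj s x u ∧ not (x ==F u)

    -- UN(x,G): neighbours with ID ≠ ID(x), one per ID class: the one with
    -- the lowest initial ID in its class
    inUN : Fin n → Bool
    inUN u = nbr u ∧ not (ident s u ≡ᵇ ident s x)
             ∧ all (λ w → not (nbr w ∧ (ident s w ≡ᵇ ident s u))
                          ∨ (initID u ≤ᵇ initID w)) (allFin n)

    inNh : Fin n → Bool
    inNh u = alive s u ∧ hadj s x u ∧ not (x ==F u)

    Sset : List (Fin n)
    Sset = filterᵇ (λ u → inUN u ∨ inNh u) (allFin n)

    module _ (L : List (Fin n)) where
      -- L is S arranged in increasing order of δ; new edges = binary tree on L
      newEdges : List (Fin n × Fin n)
      newEdges = btEdges L

      adj' : Fin n → Fin n → Bool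
      adj' u w = alive' u ∧ alive' w ∧ (adj s u w ∨ isEdge newEdges u w)

      hadj' : Fin n → Fin n → Bool
      hadj' u w = alive' u ∧ alive' w ∧ (hadj s u w ∨ isEdge newEdges u w)

  data Step (s : State n) : State n → Set where
    heal : (x : Fin n) → T (alive s x)
         → (L : List (Fin n))
         → L ↭ Sset s x
         → Linked (λ a b → δ s x a ℤ.≤ δ s x b) L
         → (id' : Fin n → ℕ)
         → (∀ u → Σ (Fin n) (λ t → t ∈ Sset s x × Reach (hadj' s x L) t u)
                → id' u ≡ minOf (ident s) (Sset s x))
         → (∀ u → ¬ Σ (Fin n) (λ t → t ∈ Sset s x × Reach (hadj' s x L) t u)
                → id' u ≡ ident s u)
         → Step s (record { alive = alive' s x ; adj = adj' s x L
                          ; hadj = hadj' s x L ; ident = id' })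

  data Exec : State n → Set where
    start : Exec initState
    next  : ∀ {s s'} → Exec s → Step s s' → Exec s'

lastOf : ∀ {A : Set} → A → List A → A
lastOf a []       = a
lastOf a (b ∷ bs) = lastOf b bs

ClosedWalk : ∀ {n} → (Fin n → Fin n → Bool) → List (Fin n) → Set
ClosedWalk h []       = Data.Bool.T false
ClosedWalk h (v ∷ vs) = Linked (λ a b → T (h a b)) (v ∷ vs) × T (h (lastOf v vs) v)

Forest : ∀ {n} → State n → Set
Forest s = ∀ vs → 3 ≤ length vs → Unique vs → All (λ v → T (alive s v)) vs
         → ¬ ClosedWalk (hadj s) vs

ConnectedSimple : ∀ {n} → (Fin n → Fin n → Bool) → Set
ConnectedSimple {n} a = (∀ u v → a u v ≡ a v u) × (∀ u → a u u ≡ false)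
                      × (∀ u v → Reach a u v)

-- An edge uv is a bridge as soon as some two-colouring of the vertices
-- changes across uv and across no other edge, and a graph in which every
-- edge has such a colouring has no cycle.  DASH keeps this property of G_h,
-- together with the fact that G_h-edges join nodes of equal ID.  When x is
-- deleted, the nodes of S lie in different pieces of G_h − x: nodes of
-- UN(x,G) have pairwise different IDs, all different from the ID of x, and
-- two G_h-neighbours of x are told apart by the colouring of the edges at x.
-- The colouring of an old edge is kept on the nodes lying in the same pieces
-- as its ends and extended by a constant; the colouring of a new tree edge,
-- membership in the subtree below it, is spread from the nodes of S over
-- their pieces.

module Submission where

open import Defs
open import Data.Bool using (Bool; true; false; _∧_; _∨_; not; T; if_then_else_)
open import Data.Bool.ListAction using (any; all; or; and)
open import Data.Bool.Properties using (T-∧; T-∨; ∨-comm; ∧-comm; ∧-assoc)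
import Data.Bool.Properties as Bool
open import Data.Empty using (⊥-elim)
open import Data.Fin using (Fin; _≟_)
open import Data.List using (List; []; _∷_; length; upTo; _++_)
open import Data.List.Membership.Propositional using (_∈_; find; lose)
open import Data.List.Membership.Propositional.Properties using (∈-allFin; ∈-concatMap⁻; ∈-++⁻; ∈-filter⁻)
open import Data.List.Properties using (map-cong-local)
open import Data.List.Relation.Binary.Permutation.Propositional using (_↭_; ↭-sym; ↭⇒↭ₛ)
open import Data.List.Relation.Binary.Permutation.Propositional.Properties using (∈-resp-↭)
import Data.List.Relation.Binary.Permutation.Setoid.Properties as Permutation
open import Data.List.Relation.Unary.All as All using (All; _∷_)
open import Data.List.Relation.Unary.All.Properties using (all⁺; all⁻)
open import Data.List.Relation.Unary.AllPairs using (_∷_)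
open import Data.List.Relation.Unary.Any as Any using (here; there)
open import Data.List.Relation.Unary.Any.Properties using (any⁺; any⁻)
open import Data.List.Relation.Unary.Linked using (Linked; _∷_)
open import Data.List.Relation.Unary.Unique.Propositional using (Unique)
open import Data.List.Relation.Unary.Unique.Propositional.Properties using (allFin⁺; filter⁺)
open import Data.Maybe using (just)
open import Data.Maybe.Properties using (just-injective)
open import Data.Nat
  using (ℕ; zero; suc; _+_; _*_; _≤_; _<_; s≤s; z≤n; _⊔_; _≡ᵇ_; _<ᵇ_; ⌊_/2⌋; ⌈_/2⌉)
import Data.Nat as ℕ
open import Data.Nat.Properties
  using (≡ᵇ⇒≡; ≡⇒≡ᵇ; <ᵇ⇒<; <⇒<ᵇ; ≤ᵇ⇒≤; ≤-reflexive; ≤-refl; ≤-trans; ≤-antisym; ≤-pred;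
         <⇒≤; <⇒≱; ≮⇒≥; <-≤-trans; m≤m+n; m≤n⇒m≤1+n; m≤n⇒m⊔n≡n; ⊔-comm; +-identityʳ;
         n≡⌊n+n/2⌋; n≡⌈n+n/2⌉; ⌊n/2⌋≤n)
open import Data.Product using (Σ; ∃₂; _×_; _,_; proj₁; proj₂)
open import Data.Sum using (_⊎_; inj₁; inj₂)
open import Function.Base using (_∘_)
open import Function.Bundles using (Equivalence)
open import Relation.Binary.PropositionalEquality using (_≡_; _≢_; refl; sym; trans; cong; cong₂; subst; setoid)
open import Relation.Nullary using (¬_; Dec; yes; no; ¬¬-map)
open import Relation.Nullary.Decidable
  using (⌊_⌋; T?; toWitness; fromWitness; toWitnessFalse; decidable-stable; ¬¬-excluded-middle)

open Equivalence using (to; from)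

T-ext : ∀ {x y} → (T x → T y) → (T y → T x) → x ≡ y
T-ext {false} {false} _ _ = refl
T-ext {false} {true}  _ g = ⊥-elim (g _)
T-ext {true}  {false} f _ = ⊥-elim (f _)
T-ext {true}  {true}  _ _ = refl

T-not-∨ : ∀ {b c} → T (not b ∨ c) → T b → T c
T-not-∨ {true} c _ = c

T-not⇒¬T : ∀ {b} → T (not b) → ¬ T b
T-not⇒¬T {false} _ ()

any-cong-∈ : ∀ {A : Set} {p q : A → Bool} {xs}
  → (∀ {x} → x ∈ xs → p x ≡ q x) → any p xs ≡ any q xs
any-cong-∈ eq = cong or (map-cong-local (All.tabulate eq))

all-cong-∈ : ∀ {A : Set} {p q : A → Bool} {xs}
  → (∀ {x} → x ∈ xs → p x ≡ q x) → all p xs ≡ all q xs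
all-cong-∈ eq = cong and (map-cong-local (All.tabulate eq))

any-select : ∀ {A : Set} (R f : A → Bool) {xs r} → r ∈ xs → T (R r)
  → (∀ {t} → t ∈ xs → T (R t) → t ≡ r) → any (λ t → R t ∧ f t) xs ≡ f r
any-select R f {xs} {r} r∈ Rr unique = T-ext found (λ fr → any⁺ _ (lose r∈ (from T-∧ (Rr , fr))))
  where
  found : T (any (λ t → R t ∧ f t) xs) → T (f r)
  found h with find (any⁻ _ xs h)
  ... | t , t∈ , h′ = let Rt , ft = to T-∧ h′ in subst (T ∘ f) (unique t∈ Rt) ft

Graph : ℕ → Set
Graph n = Fin n → Fin n → Bool

Reach-snoc : ∀ {n} {G : Graph n} {u v w} → Reach G u v → T (G v w) → Reach G u w
Reach-snoc here       e = step e here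
Reach-snoc (step e r) e′ = step e (Reach-snoc r e′)

isEdge-sym : ∀ {n} (E : List (Fin n × Fin n)) u w → isEdge E u w ≡ isEdge E w u
isEdge-sym E u w = any-cong-∈ {xs = E} λ { {a , b} _ → ∨-comm (a ==F u ∧ b ==F w) (a ==F w ∧ b ==F u) }

isEdge-witness : ∀ {n} {E : List (Fin n × Fin n)} {u w} → T (isEdge E u w)
  → ∃₂ λ p q → (p , q) ∈ E × ((p ≡ u × q ≡ w) ⊎ (p ≡ w × q ≡ u))
isEdge-witness {E = E} {u} {w} h with find (any⁻ _ E h)
... | (p , q) , e , h′ with to (T-∨ {p ==F u ∧ q ==F w}) h′
...   | inj₁ h″ = p , q , e , inj₁ (let a , b = to (T-∧ {p ==F u}) h″ in toWitness a , toWitness b)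
...   | inj₂ h″ = p , q , e , inj₂ (let a , b = to (T-∧ {p ==F w}) h″ in toWitness a , toWitness b)

record Separates {n} (G : Graph n) (c : Fin n → Bool) (u w : Fin n) : Set where
  field
    ends-differ        : c u ≢ c w
    constant-elsewhere : ∀ {a b} → T (G a b) → ¬ (a ≡ u × b ≡ w) → ¬ (a ≡ w × b ≡ u) → c a ≡ c b

-- Each edge carries a two-colouring witnessing that it is a bridge.
record Bridged {n} (G : Graph n) : Set where
  field
    cut           : Fin n → Fin n → Fin n → Bool
    cut-separates : ∀ {u w} → T (G u w) → Separates G (cut u w) u w

Separates-swap : ∀ {n} {G : Graph n} {c u w} → Separates G c u w → Separates G c w u
Separates-swap s = record
  { ends-differ        = λ eq → ends-differ (sym eq)
  ; constant-elsewhere = λ e ≢wu ≢uw → constant-elsewhere e ≢uw ≢wu }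
  where open Separates s

Separates-cong : ∀ {n} {G : Graph n} {c c′ u w}
  → (∀ v → c v ≡ c′ v) → Separates G c u w → Separates G c′ u w
Separates-cong c≗c′ s = record
  { ends-differ        = λ eq → ends-differ (trans (c≗c′ _) (trans eq (sym (c≗c′ _))))
  ; constant-elsewhere = λ e ≢uw ≢wu →
      trans (sym (c≗c′ _)) (trans (constant-elsewhere e ≢uw ≢wu) (c≗c′ _)) }
  where open Separates s

lastOf-∈ : ∀ {A : Set} (v : A) vs → lastOf v vs ∈ v ∷ vs
lastOf-∈ v []       = here refl
lastOf-∈ v (w ∷ ws) = there (lastOf-∈ w ws)

constant-along-walk : ∀ {n} {G : Graph n} (c : Fin n → Bool) {u}
  → (∀ {a b} → T (G a b) → u ≢ a → u ≢ b → c a ≡ c b)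
  → ∀ v vs → Linked (λ a b → T (G a b)) (v ∷ vs) → All (u ≢_) (v ∷ vs)
  → c v ≡ c (lastOf v vs)
constant-along-walk c closed v []       _          _ = refl
constant-along-walk c closed v (w ∷ ws) (e ∷ walk) (u≢v ∷ u≢ws) =
  trans (closed e u≢v (All.head u≢ws)) (constant-along-walk c closed w ws walk u≢ws)

-- On a cycle v₀ v₁ … v₀, the cut of the edge v₀v₁ is constant along the
-- rest of the cycle, so it cannot tell v₁ from v₀.
bridged⇒acyclic : ∀ {n} {G : Graph n} → Bridged G
  → ∀ vs → 3 ≤ length vs → Unique vs → ¬ ClosedWalk G vs
bridged⇒acyclic {G = G} B (v₀ ∷ v₁ ∷ v₂ ∷ vs) (s≤s (s≤s (s≤s _)))
                (v₀∉ ∷ v₁∉ ∷ _) ((e₀₁ ∷ walk) , closing) =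
  ends-differ (sym (trans (constant-along-walk c avoid v₁ (v₂ ∷ vs) walk v₀∉) last≡v₀))
  where
  open Separates (Bridged.cut-separates B e₀₁)
  c = Bridged.cut B v₀ v₁
  last = lastOf v₂ vs
  avoid : ∀ {a b} → T (G a b) → v₀ ≢ a → v₀ ≢ b → c a ≡ c b
  avoid e v₀≢a v₀≢b = constant-elsewhere e (λ (a≡v₀ , _) → v₀≢a (sym a≡v₀)) (λ (_ , b≡v₀) → v₀≢b (sym b≡v₀))
  last∈ : last ∈ v₂ ∷ vs
  last∈ = lastOf-∈ v₂ vs
  last≡v₀ : c last ≡ c v₀
  last≡v₀ = constant-elsewhere closing (λ p → All.lookup v₀∉ (there last∈) (sym (proj₁ p)))
                                       (λ p → All.lookup v₁∉ last∈ (sym (proj₁ p)))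

-- Removing the vertices outside A from a bridged graph H and joining
-- representatives of distinct pieces by a bridged graph with edge list E
-- gives a bridged graph.
module Gluing {n} (H : Graph n) (A : Fin n → Bool) (reps : List (Fin n))
  (Q : Fin n → Fin n → Bool) (E : List (Fin n × Fin n))
  (H-bridged : Bridged H) (E-bridged : Bridged (isEdge E))
  (E⊆reps : ∀ {a b} → T (isEdge E a b) → a ∈ reps × b ∈ reps)
  (piece-refl : ∀ {t} → t ∈ reps → T (Q t t))
  (piece-unique : ∀ {t t′} → t ∈ reps → t′ ∈ reps → T (Q t t′) → t ≡ t′)
  (piece-closed : ∀ {t a b} → t ∈ reps → T (A a) → T (A b) → T (H a b) → Q t a ≡ Q t b)
  where

  glued : Graph n
  glued a b = A a ∧ A b ∧ (H a b ∨ isEdge E a b)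

  glued-edge : ∀ {a b} → T (glued a b) → T (A a) × T (A b) × (T (H a b) ⊎ T (isEdge E a b))
  glued-edge {a} {b} e =
    let Aa , e′ = to (T-∧ {A a}) e
        Ab , e″ = to (T-∧ {A b}) e′
    in Aa , Ab , to T-∨ e″

  sameSide : Fin n → Fin n → Bool
  sameSide u v = all (λ t → ⌊ Q t v Bool.≟ Q t u ⌋) reps

  sameSide⁻ : ∀ {u v t} → T (sameSide u v) → t ∈ reps → Q t v ≡ Q t u
  sameSide⁻ h t∈ = toWitness (All.lookup (all⁺ _ reps h) t∈)

  sameSide-refl : ∀ u → T (sameSide u u)
  sameSide-refl u = all⁻ (λ t → ⌊ Q t u Bool.≟ Q t u ⌋) {reps} (All.tabulate (λ _ → fromWitness refl))

  sameSide-closed : ∀ {u a b} → T (A a) → T (A b) → T (H a b) → sameSide u a ≡ sameSide u b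
  sameSide-closed {u} Aa Ab e =
    all-cong-∈ λ {t} t∈ → cong (λ q → ⌊ q Bool.≟ Q t u ⌋) (piece-closed t∈ Aa Ab e)

  sameSide-unique : ∀ {u p q} → p ∈ reps → q ∈ reps → T (sameSide u p) → T (sameSide u q) → q ≡ p
  sameSide-unique p∈ q∈ up uq =
    sym (piece-unique p∈ q∈ (subst T (trans (sameSide⁻ up p∈) (sym (sameSide⁻ uq p∈))) (piece-refl p∈)))

  open Bridged H-bridged using (cut; cut-separates)
  open Bridged E-bridged renaming (cut to treeCut; cut-separates to treeCut-separates)

  repCut : Fin n → Fin n → Bool
  repCut u w = any (λ t → sameSide u t ∧ cut u w t) reps

  -- At most one representative lies in the same pieces as u; elsewhere the
  -- cut is frozen at its value there.
  oldCut : Fin n → Fin n → Fin n → Bool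
  oldCut u w v = if sameSide u v then cut u w v else repCut u w

  oldCut-sameSide : ∀ {u w v} → T (sameSide u v) → oldCut u w v ≡ cut u w v
  oldCut-sameSide {u} {v = v} h with sameSide u v | h
  ... | true | _ = refl

  oldCut-on-reps : ∀ {u w t} → t ∈ reps → oldCut u w t ≡ repCut u w
  oldCut-on-reps {u} {w} {t} t∈ with sameSide u t in eq
  ... | false = refl
  ... | true = sym (any-select (sameSide u) (cut u w) t∈ ut
                      (λ s∈ us → sameSide-unique t∈ s∈ ut us))
    where ut = subst T (sym eq) _

  oldCut-separates : ∀ {u w} → T (H u w) → T (A u) → T (A w) → Separates glued (oldCut u w) u w
  oldCut-separates {u} {w} e Au Aw = record
    { ends-differ = λ eq → ends-differ (trans (sym (oldCut-sameSide (sameSide-refl u)))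
                                        (trans eq (oldCut-sameSide uw)))
    ; constant-elsewhere = elsewhere }
    where
    open Separates (cut-separates e)
    uw : T (sameSide u w)
    uw = subst T (sameSide-closed Au Aw e) (sameSide-refl u)
    elsewhere : ∀ {a b} → T (glued a b) → ¬ (a ≡ u × b ≡ w) → ¬ (a ≡ w × b ≡ u)
              → oldCut u w a ≡ oldCut u w b
    elsewhere {a} {b} g ≢uw ≢wu with glued-edge g
    ... | _ , _ , inj₂ t = trans (oldCut-on-reps (proj₁ (E⊆reps t))) (sym (oldCut-on-reps (proj₂ (E⊆reps t))))
    ... | Aa , Ab , inj₁ h with sameSide u a | sameSide u b | sameSide-closed {u} Aa Ab h
    ...   | true  | .true  | refl = constant-elsewhere h ≢uw ≢wu
    ...   | false | .false | refl = refl

  newCut : Fin n → Fin n → Fin n → Bool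
  newCut u w v = any (λ t → Q t v ∧ treeCut u w t) reps

  newCut-on-reps : ∀ {u w t} → t ∈ reps → newCut u w t ≡ treeCut u w t
  newCut-on-reps {u} {w} {t} t∈ =
    any-select (λ s → Q s t) (treeCut u w) t∈ (piece-refl t∈) (λ s∈ q → piece-unique s∈ t∈ q)

  newCut-closed : ∀ {u w a b} → T (A a) → T (A b) → T (H a b) → newCut u w a ≡ newCut u w b
  newCut-closed {u} {w} Aa Ab h = any-cong-∈ λ {t} t∈ → cong (_∧ treeCut u w t) (piece-closed t∈ Aa Ab h)

  newCut-separates : ∀ {u w} → T (isEdge E u w) → Separates glued (newCut u w) u w
  newCut-separates {u} {w} e = record
    { ends-differ = λ eq → ends-differ (trans (sym (newCut-on-reps (proj₁ (E⊆reps e))))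
                                        (trans eq (newCut-on-reps (proj₂ (E⊆reps e)))))
    ; constant-elsewhere = elsewhere }
    where
    open Separates (treeCut-separates e)
    elsewhere : ∀ {a b} → T (glued a b) → ¬ (a ≡ u × b ≡ w) → ¬ (a ≡ w × b ≡ u)
              → newCut u w a ≡ newCut u w b
    elsewhere g ≢uw ≢wu with glued-edge g
    ... | Aa , Ab , inj₁ h = newCut-closed Aa Ab h
    ... | _ , _ , inj₂ t = trans (newCut-on-reps (proj₁ (E⊆reps t)))
                           (trans (constant-elsewhere t ≢uw ≢wu) (sym (newCut-on-reps (proj₂ (E⊆reps t)))))

  glued-bridged : Bridged glued
  glued-bridged = record
    { cut = λ u w → if H u w then oldCut u w else newCut u w
    ; cut-separates = separates }
    where
    separates : ∀ {u w} → T (glued u w) → Separates glued (if H u w then oldCut u w else newCut u w) u w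
    separates {u} {w} g with glued-edge g | H u w in eq
    ... | Au , Aw , _      | true  = oldCut-separates (subst T (sym eq) _) Au Aw
    ... | _  , _  , inj₂ t | false = newCut-separates t
    ... | _  , _  , inj₁ h | false = ⊥-elim (subst T eq h)

parent : ℕ → ℕ
parent zero    = zero
parent (suc k) = ⌊ k /2⌋

Child : ℕ → ℕ → Set
Child i c = c ≡ suc (2 * i) ⊎ c ≡ suc (suc (2 * i))

2*n≡n+n : ∀ n → 2 * n ≡ n + n
2*n≡n+n n = cong (n +_) (+-identityʳ n)

parent-child : ∀ {i c} → Child i c → parent c ≡ i
parent-child {i} (inj₁ refl) = trans (cong ⌊_/2⌋ (2*n≡n+n i)) (sym (n≡⌊n+n/2⌋ i))
parent-child {i} (inj₂ refl) = trans (cong ⌈_/2⌉ (2*n≡n+n i)) (sym (n≡⌈n+n/2⌉ i))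

parent<child : ∀ {i c} → Child i c → i < c
parent<child {i} (inj₁ refl) = s≤s (m≤m+n i _)
parent<child {i} (inj₂ refl) = s≤s (m≤n⇒m≤1+n (m≤m+n i _))

parent≤ : ∀ {f} k → k ≤ suc f → parent k ≤ f
parent≤ zero    _         = z≤n
parent≤ (suc k) (s≤s k≤f) = ≤-trans (⌊n/2⌋≤n k) k≤f

-- climb f j k: the walk from k towards the root, cut off after f steps, meets j
climb : ℕ → ℕ → ℕ → Bool
climb zero    j k = k ≡ᵇ j
climb (suc f) j k = (k ≡ᵇ j) ∨ ((j <ᵇ k) ∧ climb f j (parent k))

-- Since parent k < k for k > 0, the walk from k has at most k steps.
inSubtree : ℕ → ℕ → Bool
inSubtree j k = climb k j k

climb-≥ : ∀ f j k → T (climb f j k) → j ≤ k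
climb-≥ zero    j k h = ≤-reflexive (sym (≡ᵇ⇒≡ k j h))
climb-≥ (suc f) j k h with to (T-∨ {k ≡ᵇ j}) h
... | inj₁ k≡j = ≤-reflexive (sym (≡ᵇ⇒≡ k j k≡j))
... | inj₂ h′  = <⇒≤ (<ᵇ⇒< j k (proj₁ (to (T-∧ {j <ᵇ k}) h′)))

climb-fuel : ∀ f g j k → k ≤ f → k ≤ g → climb f j k ≡ climb g j k
climb-fuel zero    zero    j k       _   _   = refl
climb-fuel zero    (suc g) j zero    _   _   = sym (Bool.∨-identityʳ (zero ≡ᵇ j))
climb-fuel (suc f) zero    j zero    _   _   = Bool.∨-identityʳ (zero ≡ᵇ j)
climb-fuel (suc f) (suc g) j k       k≤f k≤g =
  cong (λ b → (k ≡ᵇ j) ∨ ((j <ᵇ k) ∧ b))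
       (climb-fuel f g j (parent k) (parent≤ k k≤f) (parent≤ k k≤g))

inSubtree-root : ∀ j → T (inSubtree j j)
inSubtree-root zero    = _
inSubtree-root (suc j) = from (T-∨ {suc j ≡ᵇ suc j}) (inj₁ (≡⇒≡ᵇ j j refl))

inSubtree-< : ∀ {j k} → k < j → inSubtree j k ≡ false
inSubtree-< {j} {k} k<j with inSubtree j k in eq
... | false = refl
... | true  = ⊥-elim (<⇒≱ k<j (climb-≥ k j k (subst T (sym eq) _)))

inSubtree-child : ∀ {j i c} → Child i c → c ≢ j → inSubtree j c ≡ inSubtree j i
inSubtree-child {j} {i} {zero}   ch _   = ⊥-elim (<⇒≱ (parent<child {i} ch) z≤n)
inSubtree-child {j} {i} {suc c}  ch c≢j with suc c ≡ᵇ j in c≡j | j <ᵇ suc c in j<c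
... | true  | _     = ⊥-elim (c≢j (≡ᵇ⇒≡ (suc c) j (subst T (sym c≡j) _)))
... | false | true  =
  trans (cong (climb c j) (parent-child ch)) (climb-fuel c i j i (≤-pred (parent<child {i} ch)) ≤-refl)
... | false | false =
  sym (inSubtree-< {j} {i} (<-≤-trans (parent<child {i} ch) (≮⇒≥ (λ lt → subst T j<c (<⇒<ᵇ lt)))))

at-∈ : ∀ {A : Set} (L : List A) k {a} → at L k ≡ just a → a ∈ L
at-∈ (b ∷ L) zero    refl = here refl
at-∈ (b ∷ L) (suc k) eq   = there (at-∈ L k eq)

-- position of the first occurrence of v in L (junk value if absent)
posOf : ∀ {n} → List (Fin n) → Fin n → ℕ
posOf []      v = zero
posOf (a ∷ L) v with a ≟ v
... | yes _ = zero
... | no  _ = suc (posOf L v)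

posOf-at : ∀ {n} (L : List (Fin n)) k {a} → Unique L → at L k ≡ just a → posOf L a ≡ k
posOf-at (b ∷ L) zero    _ refl with b ≟ b
... | yes _   = refl
... | no  b≢b = ⊥-elim (b≢b refl)
posOf-at (b ∷ L) (suc k) {a} (b∉L ∷ uniq) eq with b ≟ a
... | yes refl = ⊥-elim (All.lookup b∉L (at-∈ L k eq) refl)
... | no  _    = cong suc (posOf-at L k uniq eq)

pairOf-∈ : ∀ {A : Set} ma mb {a b : A} → (a , b) ∈ pairOf ma mb → ma ≡ just a × mb ≡ just b
pairOf-∈ (just _) (just _) (here refl) = refl , refl

childEdges : ∀ {A : Set} → List A → ℕ → List (A × A)
childEdges L i = pairOf (at L i) (at L (suc (2 * i))) ++ pairOf (at L i) (at L (suc (suc (2 * i))))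

btEdges-∈ : ∀ {A : Set} (L : List A) {a b} → (a , b) ∈ btEdges L
  → ∃₂ λ i c → Child i c × at L i ≡ just a × at L c ≡ just b
btEdges-∈ L e with Any.satisfied (∈-concatMap⁻ (childEdges L) {xs = upTo (length L)} e)
... | i , e′ with ∈-++⁻ (pairOf (at L i) (at L (suc (2 * i)))) e′
...   | inj₁ e″ = i , _ , inj₁ refl , pairOf-∈ _ _ e″
...   | inj₂ e″ = i , _ , inj₂ refl , pairOf-∈ _ _ e″

-- The subtree below the lower end of a tree edge separates it.
heapCut : ∀ {n} → List (Fin n) → Fin n → Fin n → Fin n → Bool
heapCut L u w v = inSubtree (posOf L u ⊔ posOf L w) (posOf L v)

module _ {n} {L : List (Fin n)} (uniq : Unique L) where

  heapCut-ends : ∀ {p q} → (p , q) ∈ btEdges L → heapCut L p q p ≢ heapCut L p q q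
  heapCut-ends e eq with btEdges-∈ L e
  ... | i , c , ch , atᵢ , at꜀ rewrite posOf-at L i uniq atᵢ | posOf-at L c uniq at꜀
                                     | m≤n⇒m⊔n≡n (<⇒≤ (parent<child {i} ch))
                                     | inSubtree-< {c} {i} (parent<child ch) =
    subst T (sym eq) (inSubtree-root c)

  heapCut-elsewhere : ∀ {p q p′ q′} → (p , q) ∈ btEdges L → (p′ , q′) ∈ btEdges L
    → ¬ (p′ ≡ p × q′ ≡ q) → heapCut L p q p′ ≡ heapCut L p q q′
  heapCut-elsewhere e e′ ≢pq with btEdges-∈ L e | btEdges-∈ L e′
  ... | i , c , ch , atᵢ , at꜀ | i′ , c′ , ch′ , atᵢ′ , at꜀′
    rewrite posOf-at L i uniq atᵢ | posOf-at L c uniq at꜀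
          | posOf-at L i′ uniq atᵢ′ | posOf-at L c′ uniq at꜀′
          | m≤n⇒m⊔n≡n (<⇒≤ (parent<child {i} ch)) with c′ ℕ.≟ c
  ...   | no  c′≢c = sym (inSubtree-child {i = i′} ch′ c′≢c)
  ...   | yes refl = ⊥-elim (≢pq (just-injective (trans (sym atᵢ′) (trans (cong (at L) i′≡i) atᵢ)) ,
                                  just-injective (trans (sym at꜀′) at꜀)))
    where i′≡i = trans (sym (parent-child ch′)) (parent-child ch)

heapCut-sym : ∀ {n} (L : List (Fin n)) u w v → heapCut L u w v ≡ heapCut L w u v
heapCut-sym L u w v = cong (λ j → inSubtree j (posOf L v)) (⊔-comm (posOf L u) (posOf L w))

module _ {n} {E : List (Fin n × Fin n)} (sep : Fin n → Fin n → Fin n → Bool)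
  (sep-sym : ∀ u w v → sep u w v ≡ sep w u v)
  (sep-ends : ∀ {p q} → (p , q) ∈ E → sep p q p ≢ sep p q q)
  (sep-elsewhere : ∀ {p q p′ q′} → (p , q) ∈ E → (p′ , q′) ∈ E → ¬ (p′ ≡ p × q′ ≡ q)
                  → sep p q p′ ≡ sep p q q′)
  where

  pair-separates : ∀ {p q} → (p , q) ∈ E → Separates (isEdge E) (sep p q) p q
  pair-separates {p} {q} e = record { ends-differ = sep-ends e ; constant-elsewhere = elsewhere }
    where
    elsewhere : ∀ {a b} → T (isEdge E a b) → ¬ (a ≡ p × b ≡ q) → ¬ (a ≡ q × b ≡ p)
              → sep p q a ≡ sep p q b
    elsewhere g ≢pq ≢qp with isEdge-witness g
    ... | _ , _ , e′ , inj₁ (refl , refl) = sep-elsewhere e e′ ≢pq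
    ... | _ , _ , e′ , inj₂ (refl , refl) = sym (sep-elsewhere e e′ λ (b≡p , a≡q) → ≢qp (a≡q , b≡p))

  isEdge-bridged : Bridged (isEdge E)
  isEdge-bridged = record { cut = sep ; cut-separates = separates }
    where
    separates : ∀ {u w} → T (isEdge E u w) → Separates (isEdge E) (sep u w) u w
    separates g with isEdge-witness g
    ... | _ , _ , e , inj₁ (refl , refl) = pair-separates e
    ... | _ , _ , e , inj₂ (refl , refl) = Separates-cong (sep-sym _ _) (Separates-swap (pair-separates e))

btEdges-bridged : ∀ {n} {L : List (Fin n)} → Unique L → Bridged (isEdge (btEdges L))
btEdges-bridged {L = L} uniq =
  isEdge-bridged (heapCut L) (heapCut-sym L) (heapCut-ends uniq) (heapCut-elsewhere uniq)

btEdges-endpoints : ∀ {A : Set} (L : List A) {a b} → (a , b) ∈ btEdges L → a ∈ L × b ∈ L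
btEdges-endpoints L e with btEdges-∈ L e
... | i , c , _ , atᵢ , at꜀ = at-∈ L i atᵢ , at-∈ L c at꜀

isEdge-endpoints : ∀ {n} (L : List (Fin n)) {a b} → T (isEdge (btEdges L) a b) → a ∈ L × b ∈ L
isEdge-endpoints L g with isEdge-witness g
... | _ , _ , e , inj₁ (refl , refl) = btEdges-endpoints L e
... | _ , _ , e , inj₂ (refl , refl) = let p∈ , q∈ = btEdges-endpoints L e in q∈ , p∈

module _ {n} (adj0 : Graph n) (initID : Fin n → ℕ)
         (initID-injective : ∀ u v → initID u ≡ initID v → u ≡ v) where

  open DASH adj0 initID

  record Invariant (s : State n) : Set where
    field
      hadj-sym     : ∀ u w → hadj s u w ≡ hadj s w u
      hadj-ident   : ∀ {u w} → T (hadj s u w) → ident s u ≡ ident s w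
      hadj-bridged : Bridged (hadj s)

  initial-invariant : Invariant initState
  initial-invariant = record
    { hadj-sym     = λ _ _ → refl
    ; hadj-ident   = λ ()
    ; hadj-bridged = record { cut = λ _ _ _ → true ; cut-separates = λ () } }

  module Round (s : State n) (inv : Invariant s) (x : Fin n) (L : List (Fin n)) (L↭S : L ↭ Sset s x) where

    open Invariant inv
    open Bridged hadj-bridged
    open Separates

    inS : Fin n → Bool
    inS u = inUN s x u ∨ inNh s x u

    S-cases : ∀ {t} → t ∈ Sset s x → T (inUN s x t) ⊎ T (inNh s x t)
    S-cases t∈ = to T-∨ (proj₂ (∈-filter⁻ (T? ∘ inS) {xs = allFin n} t∈))

    L⊆S : ∀ {t} → t ∈ L → t ∈ Sset s x
    L⊆S = ∈-resp-↭ L↭S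

    L-unique : Unique L
    L-unique =
      Permutation.Unique-resp-↭ (setoid (Fin n)) (↭⇒↭ₛ (↭-sym L↭S)) (filter⁺ (T? ∘ inS) (allFin⁺ n))

    alive′⇒≢x : ∀ {a} → T (alive' s x a) → x ≢ a
    alive′⇒≢x {a} h = toWitnessFalse (proj₂ (to (T-∧ {alive s a}) h))

    Nh⇒hadj : ∀ {t} → T (inNh s x t) → T (hadj s x t)
    Nh⇒hadj {t} h = proj₁ (to (T-∧ {hadj s x t}) (proj₂ (to (T-∧ {alive s t}) h)))

    Nh⇒≢x : ∀ {t} → T (inNh s x t) → x ≢ t
    Nh⇒≢x {t} h = toWitnessFalse (proj₂ (to (T-∧ {hadj s x t}) (proj₂ (to (T-∧ {alive s t}) h))))

    Nh⇒ident : ∀ {t} → T (inNh s x t) → ident s t ≡ ident s x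
    Nh⇒ident h = sym (hadj-ident (Nh⇒hadj h))

    UN⇒ident≢ : ∀ {t} → T (inUN s x t) → ident s t ≢ ident s x
    UN⇒ident≢ {t} h eq =
      T-not⇒¬T (proj₁ (to T-∧ (proj₂ (to (T-∧ {nbr s x t}) h)))) (≡⇒≡ᵇ (ident s t) (ident s x) eq)

    UN-least : ∀ {t t′} → T (inUN s x t) → T (inUN s x t′) → ident s t′ ≡ ident s t
             → initID t ≤ initID t′
    UN-least {t} {t′} h h′ eq = ≤ᵇ⇒≤ (initID t) (initID t′)
      (T-not-∨ (All.lookup (all⁺ _ (allFin n) least) (∈-allFin t′))
               (from T-∧ (proj₁ (to (T-∧ {nbr s x t′}) h′) , ≡⇒≡ᵇ (ident s t′) (ident s t) eq)))
      where least = proj₂ (to T-∧ (proj₂ (to (T-∧ {nbr s x t}) h)))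

    UN-unique : ∀ {t t′} → T (inUN s x t) → T (inUN s x t′) → ident s t′ ≡ ident s t → t ≡ t′
    UN-unique h h′ eq = initID-injective _ _ (≤-antisym (UN-least h h′ eq) (UN-least h′ h (sym eq)))

    -- The piece of t ∈ S: the nodes with t's ID and, if xt is an edge of G_h,
    -- only those on t's side of it.
    piece : Fin n → Fin n → Bool
    piece t v = (ident s v ≡ᵇ ident s t) ∧ (not (hadj s x t) ∨ ⌊ cut x t v Bool.≟ cut x t t ⌋)

    piece-refl : ∀ {t} → t ∈ Sset s x → T (piece t t)
    piece-refl {t} _ =
      from T-∧ (≡⇒≡ᵇ (ident s t) (ident s t) refl , from (T-∨ {not (hadj s x t)}) (inj₂ (fromWitness refl)))

    piece-closed : ∀ {t a b} → t ∈ Sset s x → T (alive' s x a) → T (alive' s x b) → T (hadj s a b)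
                 → piece t a ≡ piece t b
    piece-closed {t} _ Aa Ab h with hadj s x t in hxt
    ... | false = cong (λ i → (i ≡ᵇ ident s t) ∧ true) (hadj-ident h)
    ... | true  = cong₂ (λ i d → (i ≡ᵇ ident s t) ∧ ⌊ d Bool.≟ cut x t t ⌋) (hadj-ident h)
                    (constant-elsewhere (cut-separates (subst T (sym hxt) _)) h
                       (λ (a≡x , _) → alive′⇒≢x Aa (sym a≡x)) (λ (_ , b≡x) → alive′⇒≢x Ab (sym b≡x)))

    piece-unique : ∀ {t t′} → t ∈ Sset s x → t′ ∈ Sset s x → T (piece t t′) → t ≡ t′
    piece-unique {t} {t′} t∈ t′∈ h = by-cases (S-cases t∈) (S-cases t′∈)
      where
      same = proj₁ (to (T-∧ {ident s t′ ≡ᵇ ident s t}) h)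
      side = proj₂ (to (T-∧ {ident s t′ ≡ᵇ ident s t}) h)
      t′≈t : ident s t′ ≡ ident s t
      t′≈t = ≡ᵇ⇒≡ (ident s t′) (ident s t) same
      by-cases : T (inUN s x t) ⊎ T (inNh s x t) → T (inUN s x t′) ⊎ T (inNh s x t′) → t ≡ t′
      by-cases (inj₁ un) (inj₁ un′) = UN-unique un un′ t′≈t
      by-cases (inj₁ un) (inj₂ nh′) = ⊥-elim (UN⇒ident≢ un (trans (sym t′≈t) (Nh⇒ident nh′)))
      by-cases (inj₂ nh) (inj₁ un′) = ⊥-elim (UN⇒ident≢ un′ (trans t′≈t (Nh⇒ident nh)))
      by-cases (inj₂ nh) (inj₂ nh′) with t ≟ t′
      ... | yes t≡t′ = t≡t′
      ... | no  t≢t′ = ⊥-elim (ends-differ xt (trans x~t′ (toWitness (T-not-∨ side (Nh⇒hadj nh)))))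
        where
        xt = cut-separates (Nh⇒hadj nh)
        x~t′ : cut x t x ≡ cut x t t′
        x~t′ = constant-elsewhere xt (Nh⇒hadj nh′)
                 (λ (_ , t′≡t) → t≢t′ (sym t′≡t)) (λ (x≡t , _) → Nh⇒≢x nh x≡t)

    newEdges⊆S : ∀ {a b} → T (isEdge (btEdges L) a b) → a ∈ Sset s x × b ∈ Sset s x
    newEdges⊆S g = let a∈ , b∈ = isEdge-endpoints L g in L⊆S a∈ , L⊆S b∈

    module Glued = Gluing (hadj s) (alive' s x) (Sset s x) piece (btEdges L) hadj-bridged
                          (btEdges-bridged L-unique) newEdges⊆S piece-refl piece-unique piece-closed

    hadj′-sym : ∀ u w → hadj' s x L u w ≡ hadj' s x L w u
    hadj′-sym u w rewrite hadj-sym u w | isEdge-sym (btEdges L) u w =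
      trans (sym (∧-assoc (alive' s x u) (alive' s x w) _))
            (trans (cong (_∧ _) (∧-comm (alive' s x u) (alive' s x w))) (∧-assoc (alive' s x w) (alive' s x u) _))

    Reached : Fin n → Set
    Reached u = Σ (Fin n) (λ t → t ∈ Sset s x × Reach (hadj' s x L) t u)

    module _ (id′ : Fin n → ℕ)
             (reached   : ∀ u → Reached u → id′ u ≡ minOf (ident s) (Sset s x))
             (unreached : ∀ u → ¬ Reached u → id′ u ≡ ident s u) where

      -- Reachability is undecidable here, but the conclusion is a decidable equation.
      hadj′-ident : ∀ {a b} → T (hadj' s x L a b) → id′ a ≡ id′ b
      hadj′-ident {a} {b} e = decidable-stable (id′ a ℕ.≟ id′ b) (¬¬-map by-cases ¬¬-excluded-middle)
        where
        by-cases : Dec (Reached a) → id′ a ≡ id′ b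
        by-cases (yes (t , t∈ , r)) = trans (reached a (t , t∈ , r)) (sym (reached b (t , t∈ , Reach-snoc r e)))
        by-cases (no ¬ra) = trans (unreached a ¬ra) (trans old-edge (sym (unreached b ¬rb)))
          where
          ¬rb : ¬ Reached b
          ¬rb (t , t∈ , r) = ¬ra (t , t∈ , Reach-snoc r (subst T (hadj′-sym a b) e))
          old-edge : ident s a ≡ ident s b
          old-edge with Glued.glued-edge e
          ... | _ , _ , inj₁ h = hadj-ident h
          ... | _ , _ , inj₂ g = ⊥-elim (¬ra (a , proj₁ (newEdges⊆S g) , here))

  step-invariant : ∀ {s s′} → Invariant s → Step s s′ → Invariant s′
  step-invariant {s} inv (heal x _ L L↭S _ id′ reached unreached) = record
    { hadj-sym     = hadj′-sym
    ; hadj-ident   = hadj′-ident id′ reached unreached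
    ; hadj-bridged = Glued.glued-bridged }
    where open Round s inv x L L↭S

  exec-invariant : ∀ {s} → Exec s → Invariant s
  exec-invariant start        = initial-invariant
  exec-invariant (next ex st) = step-invariant (exec-invariant ex) st

lemma2p1 : ∀ {n} (adj0 : Fin n → Fin n → Bool) (initID : Fin n → ℕ)
    → ConnectedSimple adj0
    → (∀ u v → initID u ≡ initID v → u ≡ v)
    → ∀ s → DASH.Exec adj0 initID s → Forest s
lemma2p1 adj0 initID _ initID-injective s ex vs len uniq _ =
  bridged⇒acyclic (Invariant.hadj-bridged (exec-invariant adj0 initID initID-injective ex)) vs len uniq
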